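{- For every integer $x\ge 0$, $$S_{3,0}(x)=3S_{3,0}\Big(\Big\lfloor\frac{x}{4}\Big\rfloor\Big)+\Delta_3(x)-(-1)^{s_2(\lfloor x/4\rfloor-1)}A_3(x),$$ where $A_3(x)=0$ if $x\equiv 0,1,2,3\pmod 8$ and $A_3(x)=1$ if $x\equiv 4,5,6,7\pmod 8$ (so the last term is $0$ whenever $\lfloor x/4\rfloor=0$), and $$\Delta_3(x)=\begin{cases}(-1)^{s_2(x-1)}, & x\equiv 1,7,10 \pmod{12},\\ (-1)^{s_2(x-2)}, & x\equiv 2,11\pmod{12},\\ (-1)^{s_2(x-3)}, & x\equiv 3\pmod{12},\\ 0, & \text{otherwise}.\end{cases}$$
   Context: For an integer $b\ge 2$ and integer $r\ge 0$, $s_b(r)$ denotes the sum of the digits of $r$ in base $b$. For integers $x\ge 0$, define $$S_{3,0}(x)=\sum_{0\le r<x,\; r\equiv 0 \pmod 3}(-1)^{s_{2}(r)}.$$ -}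

module Defs where

open import Data.Nat using (ℕ; zero; suc; _+_; _∸_; _%_; _/_; _≡ᵇ_)
open import Data.Bool using (Bool; true; false; if_then_else_)
open import Data.Integer using (ℤ; +_; -_) renaming (_+_ to _+ℤ_)

-- binary digit sum s₂(r), computed with fuel (fuel n suffices since n/2 < n for n > 0)
s₂-fuel : ℕ → ℕ → ℕ
s₂-fuel zero    n = 0
s₂-fuel (suc f) zero = 0
s₂-fuel (suc f) n@(suc _) = n % 2 + s₂-fuel f (n / 2)

s₂ : ℕ → ℕ
s₂ n = s₂-fuel n n

neg1^ : ℕ → ℤ
neg1^ k = if (k % 2) ≡ᵇ 0 then + 1 else - (+ 1)

S₃₀ : ℕ → ℤ
S₃₀ zero = + 0
S₃₀ (suc x) = S₃₀ x +ℤ (if (x % 3) ≡ᵇ 0 then neg1^ (s₂ x) else + 0)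

A₃ : ℕ → ℤ
A₃ x with x % 8
... | 0 = + 0
... | 1 = + 0
... | 2 = + 0
... | 3 = + 0
... | _ = + 1

-- Δ₃(x) by residue of x mod 12 (truncated ∸ is exact in each nonzero case)
Δ₃ : ℕ → ℤ
Δ₃ x with x % 12
... | 1  = neg1^ (s₂ (x ∸ 1))
... | 7  = neg1^ (s₂ (x ∸ 1))
... | 10 = neg1^ (s₂ (x ∸ 1))
... | 2  = neg1^ (s₂ (x ∸ 2))
... | 11 = neg1^ (s₂ (x ∸ 2))
... | 3  = neg1^ (s₂ (x ∸ 3))
... | _  = + 0

module Submission where

-- Write tm r = (-1)^{s₂(r)} for the Thue–Morse sign and TM n = Σ_{r<n} tm r
-- for its partial sums; S = S₃₀ sums tm over the multiples of 3 below x.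
--
-- Since tm (4q + i) = tm q · tm i with (tm 0, tm 1, tm 2, tm 3) =
-- (1, -1, -1, 1), and 4q + i ≡ q + i (mod 3), the block [4q, 4q + 4)
-- contributes 3·[3 ∣ q]·tm q - tm q to S (exactly one of q, q+1, q+2 is a
-- multiple of 3).  Summing over blocks gives, for every q,
--     S (4q) = 3 S q - TM q.                                   (S-quadruple)
-- For x with q = ⌊x/4⌋ the remaining piece S x - S (4q) sums tm over the
-- multiples of 3 in [4q, x); by inspecting x mod 12 this is exactly Δ₃ x
-- (S-tail).  Finally TM q vanishes for even q and equals tm (q - 1) for odd
-- q, which by inspecting x mod 8 is the term (-1)^{s₂(q-1)} A₃ x (A-term).

open import Defs
open import Data.Bool using (true; false; if_then_else_)
open import Data.Nat
  using (ℕ; zero; suc; _∸_; _/_; _%_; _≡ᵇ_; _≤_; _<_; z≤n; s≤s; NonZero)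
  renaming (_+_ to _+ℕ_; _*_ to _*ℕ_)
import Data.Nat.Properties as ℕ
open import Data.Nat.DivMod
open import Data.Nat.Divisibility using (_∣_; divides; divides-refl; n∣m*n)
import Data.Nat.Tactic.RingSolver as ℕ-Ring
open import Data.Integer using (ℤ; +_; _+_; _-_; _*_; -_)
import Data.Integer.Properties as ℤ
open import Data.Integer.Tactic.RingSolver using (solve-∀)
open import Data.Empty using (⊥-elim)
open import Relation.Binary.PropositionalEquality
open ≡-Reasoning

half≤pred : ∀ n → suc n / 2 ≤ n
half≤pred n = ℕ.≤-pred (m/n<m (suc n) 2 (s≤s (s≤s z≤n)))

s₂-fuel-irrelevant : ∀ f g n → n ≤ f → n ≤ g → s₂-fuel f n ≡ s₂-fuel g n
s₂-fuel-irrelevant zero    zero    zero    _ _ = refl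
s₂-fuel-irrelevant zero    (suc g) zero    _ _ = refl
s₂-fuel-irrelevant (suc f) zero    zero    _ _ = refl
s₂-fuel-irrelevant (suc f) (suc g) zero    _ _ = refl
s₂-fuel-irrelevant (suc f) (suc g) (suc n) (s≤s n≤f) (s≤s n≤g) =
  cong (suc n % 2 +ℕ_)
       (s₂-fuel-irrelevant f g (suc n / 2) (ℕ.≤-trans (half≤pred n) n≤f) (ℕ.≤-trans (half≤pred n) n≤g))

s₂-suc : ∀ n → s₂ (suc n) ≡ suc n % 2 +ℕ s₂ (suc n / 2)
s₂-suc n = cong (suc n % 2 +ℕ_)
  (s₂-fuel-irrelevant n (suc n / 2) (suc n / 2) (half≤pred n) ℕ.≤-refl)

s₂-double : ∀ n → s₂ (n *ℕ 2) ≡ s₂ n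
s₂-double zero    = refl
s₂-double (suc n) = trans (s₂-suc (suc (n *ℕ 2)))
  (cong₂ _+ℕ_ (m*n%n≡0 (suc n) 2) (cong s₂ (m*n/n≡m (suc n) 2)))

s₂-double+1 : ∀ n → s₂ (1 +ℕ n *ℕ 2) ≡ 1 +ℕ s₂ n
s₂-double+1 zero    = refl
s₂-double+1 (suc n) = trans (s₂-suc (suc n *ℕ 2))
  (cong₂ _+ℕ_ ([m+kn]%n≡m%n 1 (suc n) 2)
              (cong s₂ (trans (+-distrib-/-∣ʳ 1 {d = 2} (divides-refl (suc n))) (m*n/n≡m (suc n) 2))))

neg1^-suc : ∀ k → neg1^ (suc k) ≡ - neg1^ k
neg1^-suc zero          = refl
neg1^-suc (suc zero)    = refl
neg1^-suc (suc (suc k)) = neg1^-suc k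

tm : ℕ → ℤ
tm n = neg1^ (s₂ n)

TM : ℕ → ℤ
TM zero    = + 0
TM (suc n) = TM n + tm n

tm-double : ∀ n → tm (n *ℕ 2) ≡ tm n
tm-double n = cong neg1^ (s₂-double n)

tm-double+1 : ∀ n → tm (1 +ℕ n *ℕ 2) ≡ - tm n
tm-double+1 n = trans (cong neg1^ (s₂-double+1 n)) (neg1^-suc (s₂ n))

module _ (q : ℕ) where
  private
    quad : ∀ i → i +ℕ q *ℕ 4 ≡ i +ℕ q *ℕ 2 *ℕ 2
    quad i = cong (i +ℕ_) (sym (ℕ.*-assoc q 2 2))

  tm-block₀ : tm (q *ℕ 4) ≡ tm q
  tm-block₀ = trans (cong tm (quad 0)) (trans (tm-double (q *ℕ 2)) (tm-double q))

  tm-block₁ : tm (1 +ℕ q *ℕ 4) ≡ - tm q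
  tm-block₁ = trans (cong tm (quad 1)) (trans (tm-double+1 (q *ℕ 2)) (cong -_ (tm-double q)))

  tm-block₂ : tm (2 +ℕ q *ℕ 4) ≡ - tm q
  tm-block₂ = trans (cong tm (quad 2)) (trans (tm-double (1 +ℕ q *ℕ 2)) (tm-double+1 q))

  tm-block₃ : tm (3 +ℕ q *ℕ 4) ≡ tm q
  tm-block₃ = trans (cong tm (quad 3))
    (trans (tm-double+1 (1 +ℕ q *ℕ 2)) (trans (cong -_ (tm-double+1 q)) (ℤ.neg-involutive (tm q))))

-- The partial sums vanish at even arguments: tm (2k) and tm (2k+1) cancel.
TM-even : ∀ k → TM (k *ℕ 2) ≡ + 0
TM-even zero    = refl
TM-even (suc k) = begin
  TM (k *ℕ 2) + tm (k *ℕ 2) + tm (1 +ℕ k *ℕ 2)  ≡⟨ cong₂ (λ s u → s + tm (k *ℕ 2) + u) (TM-even k) (tm-double+1 k) ⟩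
  + 0 + tm (k *ℕ 2) + - tm k                    ≡⟨ cong (λ u → + 0 + u + - tm k) (tm-double k) ⟩
  + 0 + tm k + - tm k                           ≡⟨ cancel (tm k) ⟩
  + 0                                           ∎
  where
  cancel : ∀ a → + 0 + a + - a ≡ + 0
  cancel = solve-∀

restrict₃ : ℕ → ℤ → ℤ
restrict₃ r v = if r % 3 ≡ᵇ 0 then v else + 0

summand : ℕ → ℤ
summand r = restrict₃ r (tm r)

restrict₃-periodic : ∀ r n v → 3 ∣ n → restrict₃ (r +ℕ n) v ≡ restrict₃ r v
restrict₃-periodic r n v 3∣n = cong (λ s → if s ≡ᵇ 0 then v else + 0) (%-remove-+ʳ r 3∣n)

restrict₃-neg : ∀ r v → restrict₃ r (- v) ≡ - restrict₃ r v
restrict₃-neg r v with r % 3 ≡ᵇ 0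
... | true  = refl
... | false = refl

-- Exactly one of three consecutive numbers is a multiple of 3.
restrict₃-window : ∀ q v → restrict₃ q v + restrict₃ (1 +ℕ q) v + restrict₃ (2 +ℕ q) v ≡ v
restrict₃-window zero    v = trans (ℤ.+-identityʳ (v + + 0)) (ℤ.+-identityʳ v)
restrict₃-window (suc q) v = begin
  b + c + restrict₃ (3 +ℕ q) v  ≡⟨ cong (_+_ (b + c)) wrap ⟩
  b + c + a                      ≡⟨ rotate a b c ⟩
  a + b + c                      ≡⟨ restrict₃-window q v ⟩
  v                              ∎
  where
  a = restrict₃ q v
  b = restrict₃ (1 +ℕ q) v
  c = restrict₃ (2 +ℕ q) v
  wrap : restrict₃ (3 +ℕ q) v ≡ a
  wrap = trans (cong (λ s → restrict₃ s v) (ℕ.+-comm 3 q)) (restrict₃-periodic q 3 v (divides-refl 1))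
  rotate : ∀ a b c → b + c + a ≡ a + b + c
  rotate = solve-∀

blockSum : ℕ → ℤ
blockSum q = summand (q *ℕ 4) + summand (1 +ℕ q *ℕ 4) + summand (2 +ℕ q *ℕ 4) + summand (3 +ℕ q *ℕ 4)

-- i + 4q ≡ i + q (mod 3), so the selector in block q looks at q, q+1, q+2, q+3.
summand-in-block : ∀ i q → summand (i +ℕ q *ℕ 4) ≡ restrict₃ (i +ℕ q) (tm (i +ℕ q *ℕ 4))
summand-in-block i q = trans (cong (λ s → restrict₃ s (tm (i +ℕ q *ℕ 4))) (shift i q))
                             (restrict₃-periodic (i +ℕ q) (q *ℕ 3) _ (n∣m*n q))
  where
  shift : ∀ i q → i +ℕ q *ℕ 4 ≡ i +ℕ q +ℕ q *ℕ 3
  shift = ℕ-Ring.solve-∀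

-- Block q contributes tm q - tm q - tm q + tm q restricted to q, q+1, q+2, q+3,
-- i.e. 2[3∣q] tm q - ([3∣q+1] + [3∣q+2]) tm q = 3 [3∣q] tm q - tm q.
block : ∀ q → blockSum q ≡ + 3 * summand q - tm q
block q = begin
  blockSum q
    ≡⟨ cong₂ _+_ (cong₂ _+_ (cong₂ _+_ e₀ e₁) e₂) e₃ ⟩
  a + - b + - c + a
    ≡⟨ regroup a b c ⟩
  + 3 * a - (a + b + c)
    ≡⟨ cong (λ w → + 3 * a - w) (restrict₃-window q (tm q)) ⟩
  + 3 * a - tm q
    ∎
  where
  a = restrict₃ q (tm q)
  b = restrict₃ (1 +ℕ q) (tm q)
  c = restrict₃ (2 +ℕ q) (tm q)
  e₀ : summand (q *ℕ 4) ≡ a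
  e₀ = trans (summand-in-block 0 q) (cong (restrict₃ q) (tm-block₀ q))
  e₁ : summand (1 +ℕ q *ℕ 4) ≡ - b
  e₁ = trans (summand-in-block 1 q)
             (trans (cong (restrict₃ (1 +ℕ q)) (tm-block₁ q)) (restrict₃-neg (1 +ℕ q) (tm q)))
  e₂ : summand (2 +ℕ q *ℕ 4) ≡ - c
  e₂ = trans (summand-in-block 2 q)
             (trans (cong (restrict₃ (2 +ℕ q)) (tm-block₂ q)) (restrict₃-neg (2 +ℕ q) (tm q)))
  e₃ : summand (3 +ℕ q *ℕ 4) ≡ a
  e₃ = trans (summand-in-block 3 q)
             (trans (cong (restrict₃ (3 +ℕ q)) (tm-block₃ q))
                    (trans (cong (λ s → restrict₃ s (tm q)) (ℕ.+-comm 3 q))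
                           (restrict₃-periodic q 3 (tm q) (divides-refl 1))))
  regroup : ∀ a b c → a + - b + - c + a ≡ + 3 * a - (a + b + c)
  regroup = solve-∀

S-quadruple : ∀ q → S₃₀ (q *ℕ 4) ≡ + 3 * S₃₀ q - TM q
S-quadruple zero    = refl
S-quadruple (suc q) = begin
  S₃₀ (q *ℕ 4) + summand (q *ℕ 4) + summand (1 +ℕ q *ℕ 4)
    + summand (2 +ℕ q *ℕ 4) + summand (3 +ℕ q *ℕ 4)
    ≡⟨ assoc (S₃₀ (q *ℕ 4)) _ _ _ _ ⟩
  S₃₀ (q *ℕ 4) + blockSum q
    ≡⟨ cong₂ _+_ (S-quadruple q) (block q) ⟩
  (+ 3 * S₃₀ q - TM q) + (+ 3 * summand q - tm q)
    ≡⟨ collect (S₃₀ q) (TM q) (summand q) (tm q) ⟩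
  + 3 * (S₃₀ q + summand q) - (TM q + tm q)
    ∎
  where
  assoc : ∀ s a b c d → s + a + b + c + d ≡ s + (a + b + c + d)
  assoc = solve-∀
  collect : ∀ s T a t → (+ 3 * s - T) + (+ 3 * a - t) ≡ + 3 * (s + a) - (T + t)
  collect = solve-∀

by-residue : ∀ (P : ℕ → Set) d .{{_ : NonZero d}} →
             (∀ j k → j < d → P (j +ℕ k *ℕ d)) → ∀ x → P x
by-residue P d case x = subst P (sym (m≡m%n+[m/n]*n x d)) (case (x % d) (x / d) (m%n<n x d))

quotient-shift : ∀ j k m d .{{_ : NonZero d}} → (j +ℕ k *ℕ (m *ℕ d)) / d ≡ j / d +ℕ k *ℕ m
quotient-shift j k m d = begin
  (j +ℕ k *ℕ (m *ℕ d)) / d  ≡⟨ cong (λ n → (j +ℕ n) / d) (sym (ℕ.*-assoc k m d)) ⟩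
  (j +ℕ k *ℕ m *ℕ d) / d    ≡⟨ +-distrib-/-∣ʳ j (divides-refl (k *ℕ m)) ⟩
  j / d +ℕ k *ℕ m *ℕ d / d  ≡⟨ cong (j / d +ℕ_) (m*n/n≡m (k *ℕ m) d) ⟩
  j / d +ℕ k *ℕ m           ∎

residue-shift : ∀ j k d .{{_ : NonZero d}} → j < d → (j +ℕ k *ℕ d) % d ≡ j
residue-shift j k d j<d = trans ([m+kn]%n≡m%n j k d) (m<n⇒m%n≡m j<d)

-- Δ₃ and A₃ written as functions of an explicitly given residue, so that the
-- residue can be rewritten independently of the argument.
Δ₃-of-residue : ℕ → ℕ → ℤ
Δ₃-of-residue x 1  = tm (x ∸ 1)
Δ₃-of-residue x 7  = tm (x ∸ 1)
Δ₃-of-residue x 10 = tm (x ∸ 1)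
Δ₃-of-residue x 2  = tm (x ∸ 2)
Δ₃-of-residue x 11 = tm (x ∸ 2)
Δ₃-of-residue x 3  = tm (x ∸ 3)
Δ₃-of-residue x _  = + 0

Δ₃-by-residue : ∀ x → Δ₃ x ≡ Δ₃-of-residue x (x % 12)
Δ₃-by-residue x with x % 12
... | 0  = refl
... | 1  = refl
... | 2  = refl
... | 3  = refl
... | 4  = refl
... | 5  = refl
... | 6  = refl
... | 7  = refl
... | 8  = refl
... | 9  = refl
... | 10 = refl
... | 11 = refl
... | suc (suc (suc (suc (suc (suc (suc (suc (suc (suc (suc (suc _))))))))))) = refl

A₃-of-residue : ℕ → ℤ
A₃-of-residue 0 = + 0
A₃-of-residue 1 = + 0
A₃-of-residue 2 = + 0
A₃-of-residue 3 = + 0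
A₃-of-residue _ = + 1

A₃-by-residue : ∀ x → A₃ x ≡ A₃-of-residue (x % 8)
A₃-by-residue x with x % 8
... | 0 = refl
... | 1 = refl
... | 2 = refl
... | 3 = refl
... | suc (suc (suc (suc _))) = refl

-- Crossing r + 12k adds tm (r + 12k) to S₃₀ iff 3 ∣ r, since 3 ∣ 12k.
module _ (k : ℕ) where
  private
    n = k *ℕ 12

  S-step : ∀ r → S₃₀ (suc r +ℕ n) ≡ S₃₀ (r +ℕ n) + restrict₃ r (tm (r +ℕ n))
  S-step r = cong (_+_ (S₃₀ (r +ℕ n)))
                  (restrict₃-periodic r n _ (divides (k *ℕ 4) (sym (ℕ.*-assoc k 4 3))))

  S-hit : ∀ r → (r % 3 ≡ᵇ 0) ≡ true → S₃₀ (suc r +ℕ n) ≡ S₃₀ (r +ℕ n) + tm (r +ℕ n)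
  S-hit r on = trans (S-step r) (cong (λ b → S₃₀ (r +ℕ n) + (if b then tm (r +ℕ n) else + 0)) on)

  S-skip : ∀ r → (r % 3 ≡ᵇ 0) ≡ false → S₃₀ (suc r +ℕ n) ≡ S₃₀ (r +ℕ n)
  S-skip r off = trans (S-step r)
    (trans (cong (λ b → S₃₀ (r +ℕ n) + (if b then tm (r +ℕ n) else + 0)) off)
           (ℤ.+-identityʳ (S₃₀ (r +ℕ n))))

  S-tail-residue : ∀ j → j < 12 →
    S₃₀ (j +ℕ n) ≡ S₃₀ (j / 4 *ℕ 4 +ℕ n) + Δ₃-of-residue (j +ℕ n) j
  S-tail-residue 0  _ = sym (ℤ.+-identityʳ _)
  S-tail-residue 1  _ = S-hit 0 refl
  S-tail-residue 2  _ = trans (S-skip 1 refl) (S-hit 0 refl)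
  S-tail-residue 3  _ = trans (S-skip 2 refl) (trans (S-skip 1 refl) (S-hit 0 refl))
  S-tail-residue 4  _ = sym (ℤ.+-identityʳ _)
  S-tail-residue 5  _ = trans (S-skip 4 refl) (sym (ℤ.+-identityʳ _))
  S-tail-residue 6  _ = trans (S-skip 5 refl) (trans (S-skip 4 refl) (sym (ℤ.+-identityʳ _)))
  S-tail-residue 7  _ = trans (S-hit 6 refl)
                              (cong (_+ tm (6 +ℕ n)) (trans (S-skip 5 refl) (S-skip 4 refl)))
  S-tail-residue 8  _ = sym (ℤ.+-identityʳ _)
  S-tail-residue 9  _ = trans (S-skip 8 refl) (sym (ℤ.+-identityʳ _))
  S-tail-residue 10 _ = trans (S-hit 9 refl) (cong (_+ tm (9 +ℕ n)) (S-skip 8 refl))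
  S-tail-residue 11 _ = trans (S-skip 10 refl)
                              (trans (S-hit 9 refl) (cong (_+ tm (9 +ℕ n)) (S-skip 8 refl)))
  S-tail-residue (suc (suc (suc (suc (suc (suc (suc (suc (suc (suc (suc (suc j)))))))))))) j<12 =
    ⊥-elim (ℕ.<⇒≱ j<12 (ℕ.m≤m+n 12 j))

-- S₃₀ x = S₃₀ (4⌊x/4⌋) + Δ₃ x: Δ₃ collects the multiples of 3 in [4⌊x/4⌋, x).
S-tail : ∀ x → S₃₀ x ≡ S₃₀ (x / 4 *ℕ 4) + Δ₃ x
S-tail = by-residue (λ x → S₃₀ x ≡ S₃₀ (x / 4 *ℕ 4) + Δ₃ x) 12 λ j k j<12 →
  let x = j +ℕ k *ℕ 12 in begin
  S₃₀ x
    ≡⟨ S-tail-residue k j j<12 ⟩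
  S₃₀ (j / 4 *ℕ 4 +ℕ k *ℕ 12) + Δ₃-of-residue x j
    ≡⟨ cong₂ (λ m r → S₃₀ m + Δ₃-of-residue x r) (sym (base j k)) (sym (residue-shift j k 12 j<12)) ⟩
  S₃₀ (x / 4 *ℕ 4) + Δ₃-of-residue x (x % 12)
    ≡⟨ cong (_+_ (S₃₀ (x / 4 *ℕ 4))) (sym (Δ₃-by-residue x)) ⟩
  S₃₀ (x / 4 *ℕ 4) + Δ₃ x
    ∎
  where
  base : ∀ j k → (j +ℕ k *ℕ 12) / 4 *ℕ 4 ≡ j / 4 *ℕ 4 +ℕ k *ℕ 12
  base j k = trans (cong (_*ℕ 4) (quotient-shift j k 3 4))
                   (trans (ℕ.*-distribʳ-+ 4 (j / 4) (k *ℕ 3)) (cong (j / 4 *ℕ 4 +ℕ_) (ℕ.*-assoc k 3 4)))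

-- The A₃-term is the partial Thue–Morse sum TM ⌊x/4⌋: for x = j + 8k we have
-- ⌊x/4⌋ = 2k + ⌊j/4⌋, TM (2k) = 0 and TM (2k + 1) = tm (2k).
A-term : ∀ x → neg1^ (s₂ (x / 4 ∸ 1)) * A₃ x ≡ TM (x / 4)
A-term = by-residue (λ x → neg1^ (s₂ (x / 4 ∸ 1)) * A₃ x ≡ TM (x / 4)) 8 λ j k j<8 →
  let x = j +ℕ k *ℕ 8 in begin
  neg1^ (s₂ (x / 4 ∸ 1)) * A₃ x
    ≡⟨ cong₂ (λ q a → tm (q ∸ 1) * a) (quotient-shift j k 2 4)
             (trans (A₃-by-residue x) (cong A₃-of-residue (residue-shift j k 8 j<8))) ⟩
  tm (j / 4 +ℕ k *ℕ 2 ∸ 1) * A₃-of-residue j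
    ≡⟨ by-position j k j<8 ⟩
  TM (j / 4 +ℕ k *ℕ 2)
    ≡⟨ cong TM (sym (quotient-shift j k 2 4)) ⟩
  TM (x / 4)
    ∎
  where
  low : ∀ k → tm (k *ℕ 2 ∸ 1) * + 0 ≡ TM (k *ℕ 2)
  low k = trans (ℤ.*-zeroʳ (tm (k *ℕ 2 ∸ 1))) (sym (TM-even k))
  high : ∀ k → tm (k *ℕ 2) * + 1 ≡ TM (1 +ℕ k *ℕ 2)
  high k = trans (ℤ.*-identityʳ (tm (k *ℕ 2)))
                 (trans (sym (ℤ.+-identityˡ (tm (k *ℕ 2)))) (cong (_+ tm (k *ℕ 2)) (sym (TM-even k))))
  by-position : ∀ j k → j < 8 → tm (j / 4 +ℕ k *ℕ 2 ∸ 1) * A₃-of-residue j ≡ TM (j / 4 +ℕ k *ℕ 2)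
  by-position 0 k _ = low k
  by-position 1 k _ = low k
  by-position 2 k _ = low k
  by-position 3 k _ = low k
  by-position 4 k _ = high k
  by-position 5 k _ = high k
  by-position 6 k _ = high k
  by-position 7 k _ = high k
  by-position (suc (suc (suc (suc (suc (suc (suc (suc j)))))))) k j<8 =
    ⊥-elim (ℕ.<⇒≱ j<8 (ℕ.m≤m+n 8 j))

theorem3 : (x : ℕ) →
    S₃₀ x ≡ (+ 3 * S₃₀ (x / 4) + Δ₃ x) - neg1^ (s₂ (x / 4 ∸ 1)) * A₃ x
theorem3 x = begin
  S₃₀ x                                      ≡⟨ S-tail x ⟩
  S₃₀ (q *ℕ 4) + Δ₃ x                        ≡⟨ cong (_+ Δ₃ x) (S-quadruple q) ⟩
  (+ 3 * S₃₀ q - TM q) + Δ₃ x                ≡⟨ swap (S₃₀ q) (TM q) (Δ₃ x) ⟩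
  (+ 3 * S₃₀ q + Δ₃ x) - TM q                ≡⟨ cong (_-_ (+ 3 * S₃₀ q + Δ₃ x)) (sym (A-term x)) ⟩
  (+ 3 * S₃₀ q + Δ₃ x) - neg1^ (s₂ (q ∸ 1)) * A₃ x ∎
  where
  q = x / 4
  swap : ∀ s T d → (+ 3 * s - T) + d ≡ (+ 3 * s + d) - T
  swap = solve-∀
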